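{- Let $X_1,X_2,\ldots,X_k$ be pairwise distinct finite sets. Then there exists a 2-qBMG $\overrightarrow{G}$ whose color-preserving automorphism group $\mathrm{Aut}_I(\overrightarrow{G})$ contains a normal subgroup which is the direct product $H_1\times\cdots\times H_k$, where $H_i$ is isomorphic to the symmetric group on $X_i$ for each $i$.
   Context: A digraph $\overrightarrow{G}=\overrightarrow{G}(V,E)$ has a finite vertex set $V$ and edge set $E\subseteq V\times V$ without loops ($uv$ denotes the edge with tail $u$ and head $v$; symmetric edges allowed). $N^+(v)=\{w:vw\in E\}$. Two vertices $u,v$ are independent if neither $uv$ nor $vu$ is in $E$. A 2-qBMG is a digraph, equipped with a partition $V=U\cup W$ into two color classes such that every edge joins a vertex of $U$ and a vertex of $W$, satisfying: (N1) if $u,v$ are independent then there are no vertices $w,t$ with $ut,vw,tw\in E$; (N2) if $uv,vw,wt\in E$ then $ut\in E$; (N3) if $u,v$ have a common out-neighbor then $N^+(u)\subseteq N^+(v)$ or $N^+(v)\subseteq N^+(u)$. An automorphism is a permutation $\pi$ of $V$ with $xy\in E\Rightarrow\pi(x)\pi(y)\in E$; $\mathrm{Aut}_I(\overrightarrow{G})$ is the group of automorphisms mapping $U$ to $U$ and $W$ to $W$. -}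

module Defs where

open import Data.Nat using (ℕ)
open import Data.Bool using (Bool; true; false)
open import Data.Fin using (Fin)
open import Data.Fin.Permutation using (Permutation′; _⟨$⟩ʳ_; _⟨$⟩ˡ_; _∘ₚ_; flip)
open import Data.List using (List; length)
open import Data.List.Membership.Propositional using (_∈_)
open import Data.List.Relation.Unary.Unique.Propositional using (Unique)
open import Data.Product using (Σ; _×_; ∃)
open import Data.Sum using (_⊎_)
open import Relation.Binary.PropositionalEquality using (_≡_; _≢_)
open import Relation.Nullary using (¬_)
open import Function.Bundles using (_⇔_)

-- Digraphs on the vertex set Fin n.
-- E u v ≡ true  means  uv ∈ E  (tail u, head v).
-- col : Fin n → Bool is the 2-colouring: U = {v | col v ≡ false},
-- W = {v | col v ≡ true}.

Edge : ℕ → Set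
Edge n = Fin n → Fin n → Bool

Independent : ∀ {n} → Edge n → Fin n → Fin n → Set
Independent E u v = (E u v ≡ false) × (E v u ≡ false)

OutSub : ∀ {n} → Edge n → Fin n → Fin n → Set
OutSub {n} E u v = ∀ (x : Fin n) → E u x ≡ true → E v x ≡ true

record Is2qBMG (n : ℕ) (col : Fin n → Bool) (E : Edge n) : Set where
  field
    loopless  : ∀ u → E u u ≡ false
    bipartite : ∀ u v → E u v ≡ true → col u ≢ col v
    N1 : ∀ u v → Independent E u v →
           ¬ (Σ (Fin n) λ w → Σ (Fin n) λ t →
                (E u t ≡ true) × (E v w ≡ true) × (E t w ≡ true))
    N2 : ∀ u v w t → E u v ≡ true → E v w ≡ true → E w t ≡ true →
           E u t ≡ true
    N3 : ∀ u v → (Σ (Fin n) λ x → (E u x ≡ true) × (E v x ≡ true)) →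
           OutSub E u v ⊎ OutSub E v u

_≈ₚ_ : ∀ {m} → Permutation′ m → Permutation′ m → Set
_≈ₚ_ {m} π ρ = ∀ (x : Fin m) → π ⟨$⟩ʳ x ≡ ρ ⟨$⟩ʳ x

IsAutI : ∀ {n} → (Fin n → Bool) → Edge n → Permutation′ n → Set
IsAutI {n} col E π =
  (∀ (x y : Fin n) → E x y ≡ true → E (π ⟨$⟩ʳ x) (π ⟨$⟩ʳ y) ≡ true) ×
  (∀ (x : Fin n) → col (π ⟨$⟩ʳ x) ≡ col x)

-- Sym(X_i) is realised as the permutations of the positions
-- Fin (length (X i)) of the enumeration (a bijection with X_i).

SameSet : List ℕ → List ℕ → Set
SameSet A B = ∀ (a : ℕ) → (a ∈ A) ⇔ (a ∈ B)

PairwiseDistinctFinSets : ∀ {k} → (Fin k → List ℕ) → Set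
PairwiseDistinctFinSets {k} X =
  (∀ i → Unique (X i)) × (∀ (i j : Fin k) → i ≢ j → ¬ SameSet (X i) (X j))

ProdSym : ∀ {k} → (Fin k → List ℕ) → Set
ProdSym {k} X = (i : Fin k) → Permutation′ (length (X i))

EqΠ : ∀ {k} (X : Fin k → List ℕ) → ProdSym X → ProdSym X → Set
EqΠ X g h = ∀ i → g i ≈ₚ h i

MulΠ : ∀ {k} (X : Fin k → List ℕ) → ProdSym X → ProdSym X → ProdSym X
MulΠ X g h i = g i ∘ₚ h i

record NormalEmbedding {k} (X : Fin k → List ℕ) {n : ℕ}
       (col : Fin n → Bool) (E : Edge n)
       (Φ : ProdSym X → Permutation′ n) : Set where
  field
    intoAutI   : ∀ g → IsAutI col E (Φ g)
    wellDef    : ∀ g h → EqΠ X g h → Φ g ≈ₚ Φ h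
    hom        : ∀ g h → Φ (MulΠ X g h) ≈ₚ (Φ g ∘ₚ Φ h)
    injective  : ∀ g h → Φ g ≈ₚ Φ h → EqΠ X g h
    normal     : ∀ (σ : Permutation′ n) → IsAutI col E σ → ∀ g →
                   Σ (ProdSym X) λ h → ((flip σ ∘ₚ Φ g) ∘ₚ σ) ≈ₚ Φ h

{-# OPTIONS --safe #-}
-- Take for G a disjoint union of stars, one per set X i: a centre in W and |X i| leaves in U,
-- each leaf having a single arc to its centre.  G has no directed path of length two, and two
-- leaves with a common out-neighbour belong to the same star, so (N1)-(N3) hold.  Permuting the
-- leaves of each star separately embeds Sym(X₁) × ⋯ × Sym(X_k) into Aut_I(G), and its image is
-- the set of permutations fixing every centre and mapping the leaves of each star among
-- themselves.  An automorphism maps all leaves of a star into one star, because they share their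
-- out-neighbour, so conjugation preserves this set and the image is normal.  This never uses that
-- the X i are distinct: automorphisms swapping stars of equal size are allowed.
module Submission where

open import Defs
import Algebra.Properties.Monoid.Sum
open import Data.Nat using (ℕ; zero; suc)
open import Data.Nat.Properties using (+-0-monoid)
open import Data.Bool using (Bool; true; false)
open import Data.Fin using (Fin; zero; suc)
open import Data.Fin.Properties using (_≟_; +↔⊎)
open import Data.Fin.Permutation
  using (Permutation′; permutation; _⟨$⟩ʳ_; _⟨$⟩ˡ_; _∘ₚ_; flip; inverseˡ; inverseʳ)
open import Data.List using (List; length)
open import Data.Product using (Σ; ∃; ∃₂; _×_; _,_; proj₁; proj₂)
open import Data.Sum using (_⊎_; inj₁; inj₂)
open import Data.Sum.Function.Propositional using (_⊎-↔_)
open import Data.Empty using (⊥; ⊥-elim)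
open import Function using (_∘_; _↔_; mk↔ₛ′; Inverse)
open import Function.Construct.Composition using (_↔-∘_)
open import Function.Construct.Identity using (↔-id)
open import Function.Construct.Symmetry using (↔-sym)
open import Relation.Nullary using (does; yes)
open import Relation.Nullary.Decidable using (dec-true)
open import Relation.Binary.PropositionalEquality

open Inverse using (to; from; strictlyInverseˡ; strictlyInverseʳ)
open Algebra.Properties.Monoid.Sum +-0-monoid using (sum)

Σ-suc↔⊎ : ∀ {k} (F : Fin (suc k) → ℕ) →
          Σ (Fin (suc k)) (Fin ∘ F) ↔ (Fin (F zero) ⊎ Σ (Fin k) (Fin ∘ F ∘ suc))
Σ-suc↔⊎ F = mk↔ₛ′ split unsplit split-unsplit unsplit-split
  where
  split : Σ (Fin _) (Fin ∘ F) → Fin (F zero) ⊎ Σ (Fin _) (Fin ∘ F ∘ suc)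
  split (zero  , p) = inj₁ p
  split (suc i , p) = inj₂ (i , p)
  unsplit : Fin (F zero) ⊎ Σ (Fin _) (Fin ∘ F ∘ suc) → Σ (Fin _) (Fin ∘ F)
  unsplit (inj₁ p)       = zero , p
  unsplit (inj₂ (i , p)) = suc i , p
  split-unsplit : ∀ s → split (unsplit s) ≡ s
  split-unsplit (inj₁ p)       = refl
  split-unsplit (inj₂ (i , p)) = refl
  unsplit-split : ∀ a → unsplit (split a) ≡ a
  unsplit-split (zero  , p) = refl
  unsplit-split (suc i , p) = refl

sum↔Σ : ∀ {k} (F : Fin k → ℕ) → Fin (sum F) ↔ Σ (Fin k) (Fin ∘ F)
sum↔Σ {zero}  F = mk↔ₛ′ (λ ()) (λ ()) (λ ()) (λ ())
sum↔Σ {suc k} F = ↔-sym (Σ-suc↔⊎ F) ↔-∘ ((↔-id _ ⊎-↔ sum↔Σ (F ∘ suc)) ↔-∘ +↔⊎)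

module StarForest {k : ℕ} (m : Fin k → ℕ) where

  Vertex : Set
  Vertex = Σ (Fin k) (λ i → Fin (suc (m i)))

  pattern centre i = i , zero
  pattern leaf i p = i , suc p

  colour : Vertex → Bool
  colour (centre i) = true
  colour (leaf i p) = false

  arc : Vertex → Vertex → Bool
  arc (leaf i p) (centre j) = does (i ≟ j)
  arc _          _          = false

  data Arc : Vertex → Vertex → Set where
    leaf→centre : ∀ i p → Arc (leaf i p) (centre i)

  arc-view : ∀ a b → arc a b ≡ true → Arc a b
  arc-view (leaf i p) (centre j) e with i ≟ j
  arc-view (leaf i p) (centre i) e | yes refl = leaf→centre i p

  arc-leaf-centre : ∀ i p → arc (leaf i p) (centre i) ≡ true
  arc-leaf-centre i p = dec-true (i ≟ i) refl

  arc-from-leaf : ∀ {i p} b → arc (leaf i p) b ≡ true → b ≡ centre i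
  arc-from-leaf {i} {p} b e with arc-view (leaf i p) b e
  ... | leaf→centre _ _ = refl

  arc-into-centre : ∀ a {i} → arc a (centre i) ≡ true → ∃ λ p → a ≡ leaf i p
  arc-into-centre a e with arc-view a _ e
  ... | leaf→centre i p = p , refl

  arc-irreflexive : ∀ a → arc a a ≡ false
  arc-irreflexive (centre i) = refl
  arc-irreflexive (leaf i p) = refl

  arc-bipartite : ∀ a b → arc a b ≡ true → colour a ≢ colour b
  arc-bipartite a b e with arc-view a b e
  ... | leaf→centre i p = λ ()

  no-path₂ : ∀ a b c → arc a b ≡ true → arc b c ≡ true → ⊥
  no-path₂ a b c ab bc with arc-view a b ab | arc-view b c bc
  ... | leaf→centre i p | ()

  arc-common-target : ∀ a b c d → arc a c ≡ true → arc b c ≡ true →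
                      arc a d ≡ true → arc b d ≡ true
  arc-common-target a b c d ac bc ad with arc-view a c ac | arc-view b c bc | arc-view a d ad
  ... | leaf→centre i p | leaf→centre i q | leaf→centre i p = arc-leaf-centre i q

  colour-false⇒leaf : ∀ a → colour a ≡ false → ∃₂ λ i p → a ≡ leaf i p
  colour-false⇒leaf (leaf i p) _ = i , p , refl

  leaf-injective : ∀ {i} {p q : Fin (m i)} → _≡_ {A = Vertex} (leaf i p) (leaf i q) → p ≡ q
  leaf-injective refl = refl

  IsEndomorphism : (Vertex → Vertex) → Set
  IsEndomorphism f =
    (∀ a b → arc a b ≡ true → arc (f a) (f b) ≡ true) × (∀ a → colour (f a) ≡ colour a)

  FixesCentres : (Vertex → Vertex) → Set
  FixesCentres f = ∀ a → colour a ≡ true → f a ≡ a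

  PreservesLeaves : (Vertex → Vertex) → Set
  PreservesLeaves f = ∀ i p → ∃ λ q → f (leaf i p) ≡ leaf i q

  endomorphism-preserves-stars : ∀ {f} → IsEndomorphism f → ∀ {i j p r} → f (leaf j r) ≡ leaf i p →
                                 ∀ r′ → ∃ λ q → f (leaf j r′) ≡ leaf i q
  endomorphism-preserves-stars {f} (f-arc , _) {i} {j} {r = r} fr≡ r′ =
    arc-into-centre (f (leaf j r′))
      (subst (λ c → arc (f (leaf j r′)) c ≡ true) f-centre (f-arc _ _ (arc-leaf-centre j r′)))
    where
    f-centre : f (centre j) ≡ centre i
    f-centre = arc-from-leaf (f (centre j))
      (subst (λ a → arc a (f (centre j)) ≡ true) fr≡ (f-arc _ _ (arc-leaf-centre j r)))

  module _ (σ : Vertex ↔ Vertex) (σ-endo : IsEndomorphism (to σ)) (f : Vertex → Vertex) where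

    private
      σ⁻¹-colour : ∀ a → colour (from σ a) ≡ colour a
      σ⁻¹-colour a = trans (sym (proj₂ σ-endo (from σ a))) (cong colour (strictlyInverseˡ σ a))

    conjugate-fixesCentres : FixesCentres f → FixesCentres (to σ ∘ f ∘ from σ)
    conjugate-fixesCentres f-fix a a-centre = begin
      to σ (f (from σ a)) ≡⟨ cong (to σ) (f-fix (from σ a) (trans (σ⁻¹-colour a) a-centre)) ⟩
      to σ (from σ a)     ≡⟨ strictlyInverseˡ σ a ⟩
      a                   ∎
      where open ≡-Reasoning

    conjugate-preservesLeaves : PreservesLeaves f → PreservesLeaves (to σ ∘ f ∘ from σ)
    conjugate-preservesLeaves f-leaves i p =
      let j , r , y≡ = colour-false⇒leaf (from σ (leaf i p)) (σ⁻¹-colour (leaf i p))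
          r′ , fr≡   = f-leaves j r
          σr≡        = trans (cong (to σ) (sym y≡)) (strictlyInverseˡ σ (leaf i p))
          q , σr′≡   = endomorphism-preserves-stars σ-endo σr≡ r′
      in q , (begin
        to σ (f (from σ (leaf i p))) ≡⟨ cong (to σ ∘ f) y≡ ⟩
        to σ (f (leaf j r))          ≡⟨ cong (to σ) fr≡ ⟩
        to σ (leaf j r′)             ≡⟨ σr′≡ ⟩
        leaf i q                     ∎)
      where open ≡-Reasoning

  Perms : Set
  Perms = (i : Fin k) → Permutation′ (m i)

  act : ((i : Fin k) → Fin (m i) → Fin (m i)) → Vertex → Vertex
  act f (centre i) = centre i
  act f (leaf i p) = leaf i (f i p)

  act-cong : ∀ {f g} → (∀ i p → f i p ≡ g i p) → ∀ a → act f a ≡ act g a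
  act-cong f≗g (centre i) = refl
  act-cong f≗g (leaf i p) = cong (leaf i) (f≗g i p)

  act-∘ : ∀ f g a → act (λ i → g i ∘ f i) a ≡ act g (act f a)
  act-∘ f g (centre i) = refl
  act-∘ f g (leaf i p) = refl

  act-inverse : ∀ {f g} → (∀ i p → g i (f i p) ≡ p) → ∀ a → act g (act f a) ≡ a
  act-inverse gf (centre i) = refl
  act-inverse gf (leaf i p) = cong (leaf i) (gf i p)

  act-isEndomorphism : ∀ f → IsEndomorphism (act f)
  act-isEndomorphism f = act-arc , act-colour
    where
    act-arc : ∀ a b → arc a b ≡ true → arc (act f a) (act f b) ≡ true
    act-arc a b e with arc-view a b e
    ... | leaf→centre i p = arc-leaf-centre i (f i p)
    act-colour : ∀ a → colour (act f a) ≡ colour a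
    act-colour (centre i) = refl
    act-colour (leaf i p) = refl

  act-fixesCentres : ∀ f → FixesCentres (act f)
  act-fixesCentres f (centre i) _ = refl

  act-preservesLeaves : ∀ f → PreservesLeaves (act f)
  act-preservesLeaves f i p = f i p , refl

  actₚ : Perms → Vertex ↔ Vertex
  actₚ g = mk↔ₛ′ (act (λ i → g i ⟨$⟩ʳ_)) (act (λ i → g i ⟨$⟩ˡ_))
                 (act-inverse (λ i p → inverseʳ (g i))) (act-inverse (λ i p → inverseˡ (g i)))

  leafPart : ∀ f → PreservesLeaves f → (i : Fin k) → Fin (m i) → Fin (m i)
  leafPart f f-leaves i p = proj₁ (f-leaves i p)

  act-leafPart : ∀ {f} → FixesCentres f → (f-leaves : PreservesLeaves f) →
                 ∀ a → act (leafPart f f-leaves) a ≡ f a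
  act-leafPart f-fix f-leaves (centre i) = sym (f-fix (centre i) refl)
  act-leafPart f-fix f-leaves (leaf i p) = sym (proj₂ (f-leaves i p))

  leafPart-inverse : ∀ f g (f-leaves : PreservesLeaves f) (g-leaves : PreservesLeaves g) →
                     (∀ a → f (g a) ≡ a) →
                     ∀ i p → leafPart f f-leaves i (leafPart g g-leaves i p) ≡ p
  leafPart-inverse f g f-leaves g-leaves fg i p = leaf-injective (begin
    leaf i (leafPart f f-leaves i (leafPart g g-leaves i p)) ≡⟨ sym (proj₂ (f-leaves i _)) ⟩
    f (leaf i (leafPart g g-leaves i p))                 ≡⟨ cong f (sym (proj₂ (g-leaves i p))) ⟩
    f (g (leaf i p))                                     ≡⟨ fg (leaf i p) ⟩
    leaf i p                                             ∎)
    where open ≡-Reasoning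

  restrict : (π : Vertex ↔ Vertex) → PreservesLeaves (to π) → PreservesLeaves (from π) → Perms
  restrict π to-leaves from-leaves i =
    permutation (leafPart (to π) to-leaves i) (leafPart (from π) from-leaves i)
                (leafPart-inverse (to π) (from π) to-leaves from-leaves (strictlyInverseˡ π) i)
                (leafPart-inverse (from π) (to π) from-leaves to-leaves (strictlyInverseʳ π) i)

  conjugate : Vertex ↔ Vertex → Vertex ↔ Vertex → Vertex ↔ Vertex
  conjugate τ π = τ ↔-∘ (π ↔-∘ ↔-sym τ)

  conjugate-actₚ : ∀ τ → IsEndomorphism (to τ) → ∀ g →
                   Σ Perms λ h → ∀ a → to (conjugate τ (actₚ g)) a ≡ to (actₚ h) a
  conjugate-actₚ τ τ-endo g = restrict π π-leaves π⁻¹-leaves , sym ∘ act-leafPart π-centres π-leaves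
    where
    π : Vertex ↔ Vertex
    π = conjugate τ (actₚ g)
    π-centres : FixesCentres (to π)
    π-centres = conjugate-fixesCentres τ τ-endo (to (actₚ g)) (act-fixesCentres _)
    π-leaves : PreservesLeaves (to π)
    π-leaves = conjugate-preservesLeaves τ τ-endo (to (actₚ g)) (act-preservesLeaves _)
    π⁻¹-leaves : PreservesLeaves (from π)
    π⁻¹-leaves = conjugate-preservesLeaves τ τ-endo (from (actₚ g)) (act-preservesLeaves _)

  n : ℕ
  n = sum (suc ∘ m)

  ι : Fin n ↔ Vertex
  ι = sum↔Σ (suc ∘ m)

  vertex : Fin n → Vertex
  vertex = to ι

  index : Vertex → Fin n
  index = from ι

  col : Fin n → Bool
  col = colour ∘ vertex

  E : Edge n
  E x y = arc (vertex x) (vertex y)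

  is2qBMG : Is2qBMG n col E
  is2qBMG = record
    { loopless  = arc-irreflexive ∘ vertex
    ; bipartite = λ u v → arc-bipartite (vertex u) (vertex v)
    ; N1        = λ { u _ _ (w , t , ut , _ , tw) →
                        no-path₂ (vertex u) (vertex t) (vertex w) ut tw }
    ; N2        = λ u v w _ uv vw _ → ⊥-elim (no-path₂ (vertex u) (vertex v) (vertex w) uv vw)
    ; N3        = λ { u v (x , ux , vx) → inj₁ λ y uy →
                        arc-common-target (vertex u) (vertex v) (vertex x) (vertex y) ux vx uy }
    }

  relabel : Vertex ↔ Vertex → Permutation′ n
  relabel π = ↔-sym ι ↔-∘ (π ↔-∘ ι)

  unlabel : Permutation′ n → Vertex ↔ Vertex
  unlabel σ = ι ↔-∘ (σ ↔-∘ ↔-sym ι)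

  relabel-isAutI : ∀ π → IsEndomorphism (to π) → IsAutI col E (relabel π)
  relabel-isAutI π (π-arc , π-colour) = relabel-arc , relabel-colour
    where
    relabel-arc : ∀ x y → E x y ≡ true → E (relabel π ⟨$⟩ʳ x) (relabel π ⟨$⟩ʳ y) ≡ true
    relabel-arc x y e = subst₂ (λ a b → arc a b ≡ true)
      (sym (strictlyInverseˡ ι _)) (sym (strictlyInverseˡ ι _)) (π-arc (vertex x) (vertex y) e)
    relabel-colour : ∀ x → col (relabel π ⟨$⟩ʳ x) ≡ col x
    relabel-colour x = trans (cong colour (strictlyInverseˡ ι _)) (π-colour (vertex x))

  unlabel-isEndomorphism : ∀ σ → IsAutI col E σ → IsEndomorphism (to (unlabel σ))
  unlabel-isEndomorphism σ (σ-arc , σ-colour) = unlabel-arc , unlabel-colour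
    where
    unlabel-arc : ∀ a b → arc a b ≡ true → arc (to (unlabel σ) a) (to (unlabel σ) b) ≡ true
    unlabel-arc a b e = σ-arc (index a) (index b)
      (subst₂ (λ a b → arc a b ≡ true) (sym (strictlyInverseˡ ι a)) (sym (strictlyInverseˡ ι b)) e)
    unlabel-colour : ∀ a → colour (to (unlabel σ) a) ≡ colour a
    unlabel-colour a = trans (σ-colour (index a)) (cong colour (strictlyInverseˡ ι a))

  relabel-cong : ∀ π π′ → (∀ a → to π a ≡ to π′ a) → relabel π ≈ₚ relabel π′
  relabel-cong π π′ π≗π′ x = cong index (π≗π′ (vertex x))

  relabel-injective : ∀ π π′ → relabel π ≈ₚ relabel π′ → ∀ a → to π a ≡ to π′ a
  relabel-injective π π′ eq a = begin
    to π a                           ≡⟨ cong (to π) (strictlyInverseˡ ι a) ⟨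
    to π (vertex (index a))          ≡⟨ strictlyInverseˡ ι _ ⟨
    vertex (relabel π ⟨$⟩ʳ index a)  ≡⟨ cong vertex (eq (index a)) ⟩
    vertex (relabel π′ ⟨$⟩ʳ index a) ≡⟨ strictlyInverseˡ ι _ ⟩
    to π′ (vertex (index a))         ≡⟨ cong (to π′) (strictlyInverseˡ ι a) ⟩
    to π′ a                          ∎
    where open ≡-Reasoning

  relabel-∘ : ∀ π π′ → relabel (π′ ↔-∘ π) ≈ₚ (relabel π ∘ₚ relabel π′)
  relabel-∘ π π′ x = cong (index ∘ to π′) (sym (strictlyInverseˡ ι _))

  relabel-conjugate : ∀ σ π → relabel (conjugate (unlabel σ) π) ≈ₚ ((flip σ ∘ₚ relabel π) ∘ₚ σ)
  relabel-conjugate σ π x = begin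
    index (vertex (σ ⟨$⟩ʳ index (to π (vertex (σ ⟨$⟩ˡ index (vertex x))))))
      ≡⟨ strictlyInverseʳ ι _ ⟩
    σ ⟨$⟩ʳ index (to π (vertex (σ ⟨$⟩ˡ index (vertex x))))
      ≡⟨ cong (λ y → σ ⟨$⟩ʳ index (to π (vertex (σ ⟨$⟩ˡ y)))) (strictlyInverseʳ ι x) ⟩
    σ ⟨$⟩ʳ index (to π (vertex (σ ⟨$⟩ˡ x)))
      ∎
    where open ≡-Reasoning

  Φ : Perms → Permutation′ n
  Φ = relabel ∘ actₚ

  Φ-isAutI : ∀ g → IsAutI col E (Φ g)
  Φ-isAutI g = relabel-isAutI (actₚ g) (act-isEndomorphism _)

  Φ-cong : ∀ g h → (∀ i → g i ≈ₚ h i) → Φ g ≈ₚ Φ h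
  Φ-cong g h g≈h = relabel-cong (actₚ g) (actₚ h) (act-cong g≈h)

  Φ-hom : ∀ g h → Φ (λ i → g i ∘ₚ h i) ≈ₚ (Φ g ∘ₚ Φ h)
  Φ-hom g h x = trans (relabel-cong (actₚ (λ i → g i ∘ₚ h i)) (actₚ h ↔-∘ actₚ g) (act-∘ _ _) x)
                      (relabel-∘ (actₚ g) (actₚ h) x)

  Φ-injective : ∀ g h → Φ g ≈ₚ Φ h → ∀ i → g i ≈ₚ h i
  Φ-injective g h Φg≈Φh i p = leaf-injective (relabel-injective (actₚ g) (actₚ h) Φg≈Φh (leaf i p))

  Φ-normal : ∀ σ → IsAutI col E σ → ∀ g → Σ Perms λ h → ((flip σ ∘ₚ Φ g) ∘ₚ σ) ≈ₚ Φ h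
  Φ-normal σ σ-aut g =
    let h , h-conj = conjugate-actₚ (unlabel σ) (unlabel-isEndomorphism σ σ-aut) g
    in h , λ x → trans (sym (relabel-conjugate σ (actₚ g) x))
                       (relabel-cong (conjugate (unlabel σ) (actₚ g)) (actₚ h) h-conj x)

theorem4p7 : (k : ℕ) (X : Fin k → List ℕ) → PairwiseDistinctFinSets X →
    Σ ℕ λ n → Σ (Fin n → Bool) λ col → Σ (Edge n) λ E →
    Is2qBMG n col E ×
    Σ (ProdSym X → Permutation′ n) λ Φ → NormalEmbedding X col E Φ
theorem4p7 k X _ = n , col , E , is2qBMG , Φ , record
  { intoAutI  = Φ-isAutI
  ; wellDef   = Φ-cong
  ; hom       = Φ-hom
  ; injective = Φ-injective
  ; normal    = Φ-normal
  }
  where open StarForest (length ∘ X)
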